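{- Let $r_{n,k}$ be the number of paths in $\mathcal{A}_n$ with $k$ returns to the $x$-axis, and $R(x,y)=\sum_{n,k\geq0}r_{n,k}x^ny^k$. Then $$R(x,y)=\frac{2}{2-y\left(1-x+x^2-\sqrt{x^4-2x^3-x^2-2x+1}\right)}-1.$$
   Context: A Dyck path with air pockets is a non-empty lattice path in the first quadrant starting at the origin, ending on the $x$-axis, with up-steps $U=(1,1)$ and down-steps $D_k=(1,-k)$, $k\ge1$, no two down-steps consecutive. Its length is its number of steps; $\mathcal{A}_n$ is the set of such paths of length $n$. A return to the $x$-axis is a step $D_m$ ($m\ge1$) ending on the $x$-axis. -}

module Defs where

open import Data.Bool using (Bool; true; false; _∧_; if_then_else_)
open import Data.Nat as ℕ using (ℕ; zero; suc; _∸_; _≤ᵇ_; _≡ᵇ_)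
open import Data.Integer as ℤ using (ℤ; +_; -_)
open import Data.List using (List; []; _∷_; map; concatMap; upTo; length; filterᵇ)
open import Data.Product using (Σ; _×_; _,_)
open import Relation.Binary.PropositionalEquality using (_≡_)

-- U = (1,1);  D m represents the down-step D_{m+1} = (1, -(m+1)), so k = m+1 ≥ 1.
data Step : Set where
  U : Step
  D : ℕ → Step

-- go h prevDown s : the word s, read from height h (with flag telling
-- whether the previous step was a down-step), stays in the first
-- quadrant, has no two consecutive down-steps, and ends on the x-axis.
go : ℕ → Bool → List Step → Bool
go h _     []          = h ≡ᵇ 0
go h _     (U ∷ s)     = go (suc h) false s
go h true  (D m ∷ s)   = false
go h false (D m ∷ s)   = (suc m ≤ᵇ h) ∧ go (h ∸ suc m) true s

nonEmpty : List Step → Bool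
nonEmpty []      = false
nonEmpty (_ ∷ _) = true

isAirDyck : List Step → Bool
isAirDyck p = nonEmpty p ∧ go 0 false p

returnsFrom : ℕ → List Step → ℕ
returnsFrom h []        = 0
returnsFrom h (U ∷ s)   = returnsFrom (suc h) s
returnsFrom h (D m ∷ s) =
  (if (h ∸ suc m) ≡ᵇ 0 then 1 else 0) ℕ.+ returnsFrom (h ∸ suc m) s

returns : List Step → ℕ
returns = returnsFrom 0

words : ℕ → ℕ → List (List Step)
words b zero    = [] ∷ []
words b (suc n) = concatMap (λ w → map (_∷ w) (U ∷ map D (upTo b))) (words b n)

-- Any path of length n has every down-step D_k with k ≤ n (a D_k is
-- preceded by at least k up-steps), so words n n contains all of A_n.
-- r n k = #{ p ∈ A_n | p has k returns }
r : ℕ → ℕ → ℕ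
r n k = length (filterᵇ (λ p → isAirDyck p ∧ (returns p ≡ᵇ k)) (words n n))

-- Formal power series in x, y with integer coefficients:
-- F n k = coefficient of x^n y^k.

Ser : Set
Ser = ℕ → ℕ → ℤ

sumTo : ℕ → (ℕ → ℤ) → ℤ
sumTo zero    f = f 0
sumTo (suc n) f = sumTo n f ℤ.+ f (suc n)

_⊕_ : Ser → Ser → Ser
(F ⊕ G) n k = F n k ℤ.+ G n k

_⊖_ : Ser → Ser → Ser
(F ⊖ G) n k = F n k ℤ.- G n k

_⊛_ : Ser → Ser → Ser
(F ⊛ G) n k = sumTo n (λ i → sumTo k (λ j → F i j ℤ.* G (n ∸ i) (k ∸ j)))

infixl 6 _⊕_ _⊖_
infixl 7 _⊛_

cst : ℤ → Ser
cst c zero zero = c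
cst c _    _    = + 0

X : Ser
X (suc zero) zero = + 1
X _          _    = + 0

Y : Ser
Y zero (suc zero) = + 1
Y _    _          = + 0

inX : (ℕ → ℤ) → Ser
inX f n zero    = f n
inX f n (suc k) = + 0

_≈_ : Ser → Ser → Set
F ≈ G = ∀ n k → F n k ≡ G n k

infix 4 _≈_

R : Ser
R n k = + (r n k)

Disc : Ser
Disc = X ⊛ X ⊛ X ⊛ X ⊖ cst (+ 2) ⊛ X ⊛ X ⊛ X ⊖ X ⊛ X ⊖ cst (+ 2) ⊛ X ⊕ cst (+ 1)

-- S is "the" square root of Disc: the power series in x with constant
-- term 1 whose square is Disc (this determines S uniquely).
IsSqrtDisc : (ℕ → ℤ) → Set
IsSqrtDisc S = (S 0 ≡ + 1) × (inX S ⊛ inX S ≈ Disc)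

-- A nonempty path factors uniquely at its returns into primes, paths whose only return is their
-- last step; so if Q is the series of primes, R + 1 = 1 / (1 - yQ). Removing the first up-step of a
-- prime of length n + 1 ≥ 3 and lowering the rest by one (its final down-step becoming one shorter)
-- leaves an arbitrary path of length n, and U D₁ is the only prime of length 2. Hence
-- Q = x² + x (W - 1) where W = 1 / (1 - Q) counts all paths, that is Q² = (1 - x + x²) Q - x².
-- Completing the square, (1 - x + x² - 2Q)² = Disc, so 1 - x + x² - √Disc = 2Q and the
-- denominator 2 - y (1 - x + x² - √Disc) is 2 (1 - yQ).

module Submission where

open import Defs
open import Data.Integer using (+_)
open import Data.Integer using (ℤ)
open import Data.Nat using (ℕ)
open import Data.Product using (Σ; _×_)

open import Data.Bool using (Bool; true; false; _∧_; if_then_else_)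
open import Data.Bool.Properties using (∧-zeroʳ; T-≡; ¬-not)
open import Data.Integer using (0ℤ; 1ℤ; _+_; _-_; _*_; -_)
open import Data.Integer.Properties
open import Algebra.Properties.CommutativeSemigroup +-commutativeSemigroup using (interchange)
open import Data.Integer.Tactic.RingSolver using (solve-∀)
open import Data.List using (List; []; _∷_; map; concatMap; applyUpTo; length; filterᵇ; _++_)
open import Data.Nat as ℕ using (zero; suc; _∸_; _≤_; _<_; _≤′_; ≤′-refl; ≤′-step; _≤ᵇ_; _≡ᵇ_; z≤n; s≤s)
import Data.Nat.Properties as ℕₚ
open import Data.Product using (_,_; proj₂)
open import Data.Sum using (inj₁; inj₂)
open import Function using (_∘_; id)
open import Function.Bundles using (Equivalence)
open import Relation.Binary.PropositionalEquality
open ≡-Reasoning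

sumTo-cong : ∀ n {f g : ℕ → ℤ} → (∀ i → i ≤ n → f i ≡ g i) → sumTo n f ≡ sumTo n g
sumTo-cong zero    f≡g = f≡g 0 z≤n
sumTo-cong (suc n) f≡g =
  cong₂ _+_ (sumTo-cong n (λ i i≤n → f≡g i (ℕₚ.m≤n⇒m≤1+n i≤n))) (f≡g (suc n) ℕₚ.≤-refl)

sumTo-cons : ∀ n (f : ℕ → ℤ) → sumTo (suc n) f ≡ f 0 + sumTo n (f ∘ suc)
sumTo-cons zero    f = refl
sumTo-cons (suc n) f =
  trans (cong (_+ f (suc (suc n))) (sumTo-cons n f)) (+-assoc (f 0) (sumTo n (f ∘ suc)) _)

sumTo-zero : ∀ n {f : ℕ → ℤ} → (∀ i → f i ≡ 0ℤ) → sumTo n f ≡ 0ℤ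
sumTo-zero zero    f≡0 = f≡0 0
sumTo-zero (suc n) f≡0 = cong₂ _+_ (sumTo-zero n f≡0) (f≡0 (suc n))

sumTo-head : ∀ n (f : ℕ → ℤ) → (∀ i → f (suc i) ≡ 0ℤ) → sumTo n f ≡ f 0
sumTo-head zero    f _   = refl
sumTo-head (suc n) f f≡0 = trans (cong₂ _+_ (sumTo-head n f f≡0) (f≡0 n)) (+-identityʳ (f 0))

sumTo-+ : ∀ n (f g : ℕ → ℤ) → sumTo n (λ i → f i + g i) ≡ sumTo n f + sumTo n g
sumTo-+ zero    f g = refl
sumTo-+ (suc n) f g =
  trans (cong (_+ (f (suc n) + g (suc n))) (sumTo-+ n f g)) (interchange (sumTo n f) (sumTo n g) (f (suc n)) (g (suc n)))

sumTo-neg : ∀ n (f : ℕ → ℤ) → sumTo n (λ i → - f i) ≡ - sumTo n f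
sumTo-neg zero    f = refl
sumTo-neg (suc n) f =
  trans (cong (_+ - f (suc n)) (sumTo-neg n f)) (sym (neg-distrib-+ (sumTo n f) (f (suc n))))

sumTo-- : ∀ n (f g : ℕ → ℤ) → sumTo n (λ i → f i - g i) ≡ sumTo n f - sumTo n g
sumTo-- n f g = trans (sumTo-+ n f (λ i → - g i)) (cong (_+_ (sumTo n f)) (sumTo-neg n g))

sumTo-*ˡ : ∀ n a (f : ℕ → ℤ) → sumTo n (λ i → a * f i) ≡ a * sumTo n f
sumTo-*ˡ zero    a f = refl
sumTo-*ˡ (suc n) a f =
  trans (cong (_+ a * f (suc n)) (sumTo-*ˡ n a f)) (sym (*-distribˡ-+ a (sumTo n f) (f (suc n))))

sumTo-*ʳ : ∀ n a (f : ℕ → ℤ) → sumTo n (λ i → f i * a) ≡ sumTo n f * a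
sumTo-*ʳ zero    a f = refl
sumTo-*ʳ (suc n) a f =
  trans (cong (_+ f (suc n) * a) (sumTo-*ʳ n a f)) (sym (*-distribʳ-+ a (sumTo n f) (f (suc n))))

sumTo-reverse : ∀ n (f : ℕ → ℤ) → sumTo n f ≡ sumTo n (λ i → f (n ∸ i))
sumTo-reverse zero    f = refl
sumTo-reverse (suc n) f = begin
  sumTo n f + f (suc n)                          ≡⟨ +-comm (sumTo n f) (f (suc n)) ⟩
  f (suc n) + sumTo n f                          ≡⟨ cong (_+_ (f (suc n))) (sumTo-reverse n f) ⟩
  f (suc n) + sumTo n (λ i → f (n ∸ i))          ≡⟨ sumTo-cons n (λ i → f (suc n ∸ i)) ⟨
  sumTo (suc n) (λ i → f (suc n ∸ i))            ∎

sumTo-reflect : ∀ n (f : ℕ → ℕ → ℤ) → sumTo n (λ i → f i (n ∸ i)) ≡ sumTo n (λ i → f (n ∸ i) i)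
sumTo-reflect n f =
  trans (sumTo-reverse n (λ i → f i (n ∸ i)))
        (sumTo-cong n (λ i i≤n → cong (f (n ∸ i)) (ℕₚ.m∸[m∸n]≡n i≤n)))

sumTo-swap : ∀ n m (F : ℕ → ℕ → ℤ) →
             sumTo n (λ i → sumTo m (F i)) ≡ sumTo m (λ j → sumTo n (λ i → F i j))
sumTo-swap n zero    F = refl
sumTo-swap n (suc m) F =
  trans (sumTo-+ n (λ i → sumTo m (F i)) (λ i → F i (suc m)))
        (cong (_+ sumTo n (λ i → F i (suc m))) (sumTo-swap n m F))

sumBelow : ℕ → (ℕ → ℤ) → ℤ
sumBelow zero    f = 0ℤ
sumBelow (suc h) f = sumTo h f

sumBelow-cong : ∀ h {f g : ℕ → ℤ} → (∀ j → j < h → f j ≡ g j) → sumBelow h f ≡ sumBelow h g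
sumBelow-cong zero    f≡g = refl
sumBelow-cong (suc h) f≡g = sumTo-cong h (λ j j≤h → f≡g j (s≤s j≤h))

sumBelow-cons : ∀ h (f : ℕ → ℤ) → sumBelow (suc h) f ≡ f 0 + sumBelow h (f ∘ suc)
sumBelow-cons zero    f = sym (+-identityʳ (f 0))
sumBelow-cons (suc h) f = sumTo-cons h f

sumBelow-snoc : ∀ h (f : ℕ → ℤ) → sumBelow (suc h) f ≡ sumBelow h f + f h
sumBelow-snoc zero    f = sym (+-identityˡ (f 0))
sumBelow-snoc (suc h) f = refl

sumBelow-zero : ∀ h {f : ℕ → ℤ} → (∀ j → f j ≡ 0ℤ) → sumBelow h f ≡ 0ℤ
sumBelow-zero zero    f≡0 = refl
sumBelow-zero (suc h) f≡0 = sumTo-zero h f≡0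

sumBelow-reverse : ∀ h (f : ℕ → ℤ) → sumBelow h (λ m → f (h ∸ suc m)) ≡ sumBelow h f
sumBelow-reverse zero    f = refl
sumBelow-reverse (suc h) f = sym (sumTo-reverse h f)

sumBelow-truncate : ∀ {h b} (f : ℕ → ℤ) → h ≤ b → (∀ m → h ≤ m → f m ≡ 0ℤ) →
                    sumBelow b f ≡ sumBelow h f
sumBelow-truncate {h} f h≤b f≡0 = extend (ℕₚ.≤⇒≤′ h≤b)
  where
  extend : ∀ {b} → h ≤′ b → sumBelow b f ≡ sumBelow h f
  extend ≤′-refl            = refl
  extend (≤′-step {b} h≤′b) = begin
    sumBelow (suc b) f    ≡⟨ sumBelow-snoc b f ⟩
    sumBelow b f + f b    ≡⟨ cong₂ _+_ (extend h≤′b) (f≡0 b (ℕₚ.≤′⇒≤ h≤′b)) ⟩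
    sumBelow h f + 0ℤ     ≡⟨ +-identityʳ _ ⟩
    sumBelow h f          ∎

sumBelow-*ʳ : ∀ h a (f : ℕ → ℤ) → sumBelow h f * a ≡ sumBelow h (λ j → f j * a)
sumBelow-*ʳ zero    a f = refl
sumBelow-*ʳ (suc h) a f = sym (sumTo-*ʳ h a f)

sumTo-sumBelow-swap : ∀ n h (F : ℕ → ℕ → ℤ) →
                      sumTo n (λ i → sumBelow h (F i)) ≡ sumBelow h (λ j → sumTo n (λ i → F i j))
sumTo-sumBelow-swap n zero    F = sumTo-zero n (λ _ → refl)
sumTo-sumBelow-swap n (suc h) F = sumTo-swap n h F

infixl 7 _⋆_

_⋆_ : (ℕ → ℤ) → (ℕ → ℤ) → ℕ → ℤ
(a ⋆ b) n = sumTo n (λ i → a i * b (n ∸ i))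

δ₀ : ℕ → ℤ
δ₀ zero    = 1ℤ
δ₀ (suc _) = 0ℤ

shift : (ℕ → ℤ) → ℕ → ℤ
shift a zero    = 0ℤ
shift a (suc n) = a n

shift-cong : ∀ {a b} → a ≗ b → shift a ≗ shift b
shift-cong a≗b zero    = refl
shift-cong a≗b (suc n) = a≗b n

⋆-cong : ∀ {a a′ b b′} → a ≗ a′ → b ≗ b′ → a ⋆ b ≗ a′ ⋆ b′
⋆-cong a≗a′ b≗b′ n = sumTo-cong n (λ i _ → cong₂ _*_ (a≗a′ i) (b≗b′ (n ∸ i)))

⋆-comm : ∀ a b → a ⋆ b ≗ b ⋆ a
⋆-comm a b n =
  trans (sumTo-reflect n (λ i j → a i * b j)) (sumTo-cong n (λ i _ → *-comm (a (n ∸ i)) (b i)))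

δ₀-⋆ : ∀ b → δ₀ ⋆ b ≗ b
δ₀-⋆ b n = trans (sumTo-head n (λ i → δ₀ i * b (n ∸ i)) (λ _ → refl)) (*-identityˡ (b n))

shift-⋆ : ∀ a b → shift a ⋆ b ≗ shift (a ⋆ b)
shift-⋆ a b zero    = refl
shift-⋆ a b (suc n) = trans (sumTo-cons n (λ i → shift a i * b (suc n ∸ i))) (+-identityˡ _)

shift-δ₀-⋆ : ∀ b → shift δ₀ ⋆ b ≗ shift b
shift-δ₀-⋆ b n = trans (shift-⋆ δ₀ b n) (shift-cong (δ₀-⋆ b) n)

⋆-distribʳ-+ : ∀ a a′ b n → ((λ i → a i + a′ i) ⋆ b) n ≡ (a ⋆ b) n + (a′ ⋆ b) n
⋆-distribʳ-+ a a′ b n =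
  trans (sumTo-cong n (λ i _ → *-distribʳ-+ (b (n ∸ i)) (a i) (a′ i)))
        (sumTo-+ n (λ i → a i * b (n ∸ i)) (λ i → a′ i * b (n ∸ i)))

⋆-distribʳ-- : ∀ a a′ b n → ((λ i → a i - a′ i) ⋆ b) n ≡ (a ⋆ b) n - (a′ ⋆ b) n
⋆-distribʳ-- a a′ b n =
  trans (sumTo-cong n (λ i _ → distrib (a i) (a′ i) (b (n ∸ i))))
        (sumTo-- n (λ i → a i * b (n ∸ i)) (λ i → a′ i * b (n ∸ i)))
  where
  distrib : ∀ (x y z : ℤ) → (x - y) * z ≡ x * z - y * z
  distrib = solve-∀

⋆-scaleˡ : ∀ c a b n → ((λ i → c * a i) ⋆ b) n ≡ c * (a ⋆ b) n
⋆-scaleˡ c a b n =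
  trans (sumTo-cong n (λ i _ → *-assoc c (a i) (b (n ∸ i)))) (sumTo-*ˡ n c (λ i → a i * b (n ∸ i)))

⋆-suc : ∀ a b n → a 0 ≡ 0ℤ → (a ⋆ b) (suc n) ≡ ((a ∘ suc) ⋆ b) n
⋆-suc a b n a₀≡0 = begin
  (a ⋆ b) (suc n)                         ≡⟨ sumTo-cons n (λ i → a i * b (suc n ∸ i)) ⟩
  a 0 * b (suc n) + ((a ∘ suc) ⋆ b) n     ≡⟨ cong (λ t → t * b (suc n) + ((a ∘ suc) ⋆ b) n) a₀≡0 ⟩
  0ℤ + ((a ∘ suc) ⋆ b) n                  ≡⟨ +-identityˡ _ ⟩
  ((a ∘ suc) ⋆ b) n                       ∎

quadratic : ℕ → ℤ
quadratic n = δ₀ n - shift δ₀ n + shift (shift δ₀) n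

quadratic-⋆ : ∀ a n → (quadratic ⋆ a) n ≡ a n - shift a n + shift (shift a) n
quadratic-⋆ a n = begin
  (quadratic ⋆ a) n
    ≡⟨ ⋆-distribʳ-+ (λ i → δ₀ i - shift δ₀ i) (shift (shift δ₀)) a n ⟩
  ((λ i → δ₀ i - shift δ₀ i) ⋆ a) n + (shift (shift δ₀) ⋆ a) n
    ≡⟨ cong₂ _+_ (⋆-distribʳ-- δ₀ (shift δ₀) a n) shift²-⋆ ⟩
  (δ₀ ⋆ a) n - (shift δ₀ ⋆ a) n + shift (shift a) n
    ≡⟨ cong₂ (λ s t → s - t + shift (shift a) n) (δ₀-⋆ a n) (shift-δ₀-⋆ a n) ⟩
  a n - shift a n + shift (shift a) n
    ∎
  where
  shift²-⋆ : (shift (shift δ₀) ⋆ a) n ≡ shift (shift a) n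
  shift²-⋆ = trans (shift-⋆ (shift δ₀) a n) (shift-cong (shift-δ₀-⋆ a) n)

⋆-by-difference : ∀ c q e n →
                  ((λ i → c i - + 2 * q i) ⋆ e) n ≡ (c ⋆ e) n - + 2 * (q ⋆ e) n
⋆-by-difference c q e n =
  trans (⋆-distribʳ-- c (λ i → + 2 * q i) e n) (cong (_-_ ((c ⋆ e) n)) (⋆-scaleˡ (+ 2) q e n))

square-completion : ∀ (c q d : ℕ → ℤ) → q ⋆ q ≗ (λ n → (c ⋆ q) n - d n) →
                    (λ i → c i - + 2 * q i) ⋆ (λ i → c i - + 2 * q i) ≗ (λ n → (c ⋆ c) n - + 4 * d n)
square-completion c q d q²≗ n = begin
  (s ⋆ s) n
    ≡⟨ ⋆-by-difference c q s n ⟩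
  (c ⋆ s) n - + 2 * (q ⋆ s) n
    ≡⟨ cong₂ (λ u v → u - + 2 * v) (⋆-comm c s n) (⋆-comm q s n) ⟩
  (s ⋆ c) n - + 2 * (s ⋆ q) n
    ≡⟨ cong₂ (λ u v → u - + 2 * v) (⋆-by-difference c q c n) (⋆-by-difference c q q n) ⟩
  (c ⋆ c) n - + 2 * (q ⋆ c) n - + 2 * ((c ⋆ q) n - + 2 * (q ⋆ q) n)
    ≡⟨ cong₂ (λ u v → (c ⋆ c) n - + 2 * u - + 2 * ((c ⋆ q) n - + 2 * v)) (⋆-comm q c n) (q²≗ n) ⟩
  (c ⋆ c) n - + 2 * (c ⋆ q) n - + 2 * ((c ⋆ q) n - + 2 * ((c ⋆ q) n - d n))
    ≡⟨ expand ((c ⋆ c) n) ((c ⋆ q) n) (d n) ⟩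
  (c ⋆ c) n - + 4 * d n
    ∎
  where
  s : ℕ → ℤ
  s i = c i - + 2 * q i
  expand : ∀ (cc cq dd : ℤ) → cc - + 2 * cq - + 2 * (cq - + 2 * (cq - dd)) ≡ cc - + 4 * dd
  expand = solve-∀

middle : (ℕ → ℤ) → ℕ → ℤ
middle a zero    = 0ℤ
middle a (suc m) = sumTo m (λ i → a (suc i) * a (suc m ∸ i))

middle-cong : ∀ {a b} m → (∀ j → j ≤ m → a j ≡ b j) → middle a m ≡ middle b m
middle-cong zero    _   = refl
middle-cong (suc m) a≡b =
  sumTo-cong m (λ i i≤m → cong₂ _*_ (a≡b (suc i) (s≤s i≤m)) (a≡b (suc m ∸ i) (ℕₚ.m∸n≤m (suc m) i)))

⋆-square-suc : ∀ a m → (a ⋆ a) (suc m) ≡ a 0 * a (suc m) + (middle a m + a (suc m) * a 0)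
⋆-square-suc a zero    = cong (_+_ (a 0 * a 1)) (sym (+-identityˡ _))
⋆-square-suc a (suc m) =
  trans (sumTo-cons (suc m) (λ i → a i * a (suc (suc m) ∸ i)))
        (cong (λ t → a 0 * a (suc (suc m)) + (middle a (suc m) + a (suc (suc m)) * a t)) (ℕₚ.n∸n≡0 m))

⋆-square-unique : ∀ a b → a 0 ≡ 1ℤ → b 0 ≡ 1ℤ → a ⋆ a ≗ b ⋆ b → a ≗ b
⋆-square-unique a b a₀≡1 b₀≡1 a²≗b² n = agreeUpTo n n ℕₚ.≤-refl
  where
  twice : ∀ c → c 0 ≡ 1ℤ → ∀ m → + 2 * c (suc m) ≡ (c ⋆ c) (suc m) - middle c m
  twice c c₀≡1 m = begin
    + 2 * c (suc m)
      ≡⟨ collect (c (suc m)) (middle c m) ⟩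
    1ℤ * c (suc m) + (middle c m + c (suc m) * 1ℤ) - middle c m
      ≡⟨ cong (λ t → t * c (suc m) + (middle c m + c (suc m) * t) - middle c m) (sym c₀≡1) ⟩
    c 0 * c (suc m) + (middle c m + c (suc m) * c 0) - middle c m
      ≡⟨ cong (_- middle c m) (⋆-square-suc c m) ⟨
    (c ⋆ c) (suc m) - middle c m
      ∎
    where
    collect : ∀ (x μ : ℤ) → + 2 * x ≡ 1ℤ * x + (μ + x * 1ℤ) - μ
    collect = solve-∀
  agreeUpTo : ∀ m j → j ≤ m → a j ≡ b j
  agreeUpTo zero    zero    z≤n   = trans a₀≡1 (sym b₀≡1)
  agreeUpTo (suc m) j       j≤1+m with ℕₚ.m≤n⇒m<n∨m≡n j≤1+m
  ... | inj₁ (s≤s j≤m) = agreeUpTo m j j≤m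
  ... | inj₂ refl      = *-cancelˡ-≡ (+ 2) (a (suc m)) (b (suc m)) (begin
    + 2 * a (suc m)                    ≡⟨ twice a a₀≡1 m ⟩
    (a ⋆ a) (suc m) - middle a m       ≡⟨ cong₂ _-_ (a²≗b² (suc m)) (middle-cong m (agreeUpTo m)) ⟩
    (b ⋆ b) (suc m) - middle b m       ≡⟨ twice b b₀≡1 m ⟨
    + 2 * b (suc m)                    ∎)

shiftX : Ser → Ser
shiftX F n k = shift (λ i → F i k) n

shiftY : Ser → Ser
shiftY F n k = shift (F n) k

≈-refl : ∀ {F} → F ≈ F
≈-refl n k = refl

≈-trans : ∀ {F G H} → F ≈ G → G ≈ H → F ≈ H
≈-trans F≈G G≈H n k = trans (F≈G n k) (G≈H n k)

shiftX-cong : ∀ {F G} → F ≈ G → shiftX F ≈ shiftX G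
shiftX-cong F≈G n k = shift-cong (λ i → F≈G i k) n

shiftY-cong : ∀ {F G} → F ≈ G → shiftY F ≈ shiftY G
shiftY-cong F≈G n k = shift-cong (F≈G n) k

inX-cong : ∀ {a b} → a ≗ b → inX a ≈ inX b
inX-cong a≗b n zero    = a≗b n
inX-cong a≗b n (suc k) = refl

inX-⊖ : ∀ a b → inX a ⊖ inX b ≈ inX (λ n → a n - b n)
inX-⊖ a b n zero    = refl
inX-⊖ a b n (suc k) = refl

⊛-cong : ∀ {F F′ G G′} → F ≈ F′ → G ≈ G′ → F ⊛ G ≈ F′ ⊛ G′
⊛-cong F≈F′ G≈G′ n k =
  sumTo-cong n (λ i _ → sumTo-cong k (λ j _ → cong₂ _*_ (F≈F′ i j) (G≈G′ (n ∸ i) (k ∸ j))))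

⊛-distribʳ-⊖ : ∀ F G H → (F ⊖ G) ⊛ H ≈ F ⊛ H ⊖ G ⊛ H
⊛-distribʳ-⊖ F G H n k =
  trans (sumTo-cong n (λ i _ →
           trans (sumTo-cong k (λ j _ → distrib (F i j) (G i j) (H (n ∸ i) (k ∸ j))))
                 (sumTo-- k (λ j → F i j * H (n ∸ i) (k ∸ j)) (λ j → G i j * H (n ∸ i) (k ∸ j)))))
        (sumTo-- n (λ i → sumTo k (λ j → F i j * H (n ∸ i) (k ∸ j)))
                   (λ i → sumTo k (λ j → G i j * H (n ∸ i) (k ∸ j))))
  where
  distrib : ∀ (x y z : ℤ) → (x - y) * z ≡ x * z - y * z
  distrib = solve-∀

⊛-comm : ∀ F G → F ⊛ G ≈ G ⊛ F
⊛-comm F G n k =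
  trans (sumTo-reflect n (λ i i′ → sumTo k (λ j → F i j * G i′ (k ∸ j))))
        (sumTo-cong n (λ i _ →
           trans (sumTo-reflect k (λ j j′ → F (n ∸ i) j * G i j′))
                 (sumTo-cong k (λ j _ → *-comm (F (n ∸ i) (k ∸ j)) (G i j)))))

cst-⊛ : ∀ a F n k → (cst a ⊛ F) n k ≡ a * F n k
cst-⊛ a F n k =
  trans (sumTo-head n (λ i → sumTo k (λ j → cst a i j * F (n ∸ i) (k ∸ j))) (λ i → sumTo-zero k (λ j → refl)))
        (sumTo-head k (λ j → cst a 0 j * F n (k ∸ j)) (λ j → refl))

inX-⊛ : ∀ a F n k → (inX a ⊛ F) n k ≡ (a ⋆ (λ i → F i k)) n
inX-⊛ a F n k = sumTo-cong n (λ i _ → sumTo-head k (λ j → inX a i j * F (n ∸ i) (k ∸ j)) (λ j → refl))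

inX-⊛-inX : ∀ a b → inX a ⊛ inX b ≈ inX (a ⋆ b)
inX-⊛-inX a b n zero    = inX-⊛ a (inX b) n 0
inX-⊛-inX a b n (suc k) = trans (inX-⊛ a (inX b) n (suc k)) (sumTo-zero n (λ i → *-zeroʳ (a i)))

shiftY-⊛ : ∀ F H → shiftY F ⊛ H ≈ shiftY (F ⊛ H)
shiftY-⊛ F H n zero    = sumTo-zero n (λ i → refl)
shiftY-⊛ F H n (suc k) =
  sumTo-cong n (λ i _ → trans (sumTo-cons k (λ j → shiftY F i j * H (n ∸ i) (suc k ∸ j))) (+-identityˡ _))

X≈inX : X ≈ inX (shift δ₀)
X≈inX zero                zero    = refl
X≈inX (suc zero)          zero    = refl
X≈inX (suc (suc n))       zero    = refl
X≈inX zero                (suc k) = refl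
X≈inX (suc zero)          (suc k) = refl
X≈inX (suc (suc n))       (suc k) = refl

X-⊛ : ∀ F → X ⊛ F ≈ shiftX F
X-⊛ F n k = begin
  (X ⊛ F) n k                         ≡⟨ ⊛-cong X≈inX (≈-refl {F}) n k ⟩
  (inX (shift δ₀) ⊛ F) n k            ≡⟨ inX-⊛ (shift δ₀) F n k ⟩
  (shift δ₀ ⋆ (λ i → F i k)) n        ≡⟨ shift-δ₀-⋆ (λ i → F i k) n ⟩
  shiftX F n k                        ∎

⊛-X : ∀ {F G} → F ≈ G → F ⊛ X ≈ shiftX G
⊛-X {F} F≈G n k = trans (⊛-comm F X n k) (trans (X-⊛ F n k) (shiftX-cong F≈G n k))

Y≈shiftY : Y ≈ shiftY (cst (+ 1))
Y≈shiftY zero    zero          = refl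
Y≈shiftY zero    (suc zero)    = refl
Y≈shiftY zero    (suc (suc k)) = refl
Y≈shiftY (suc n) zero          = refl
Y≈shiftY (suc n) (suc zero)    = refl
Y≈shiftY (suc n) (suc (suc k)) = refl

Y-⊛ : ∀ F → Y ⊛ F ≈ shiftY F
Y-⊛ F = ≈-trans (⊛-cong Y≈shiftY (≈-refl {F})) (≈-trans (shiftY-⊛ (cst (+ 1)) F) (shiftY-cong unit))
  where
  unit : cst (+ 1) ⊛ F ≈ F
  unit n k = trans (cst-⊛ (+ 1) F n k) (*-identityˡ (F n k))

quadratic-series : cst (+ 1) ⊖ X ⊕ X ⊛ X ≈ inX quadratic
quadratic-series n k rewrite ⊛-X (≈-refl {X}) n k = evaluate n k
  where
  evaluate : ∀ n k → cst (+ 1) n k - X n k + shiftX X n k ≡ inX quadratic n k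
  evaluate zero                      zero    = refl
  evaluate (suc zero)                zero    = refl
  evaluate (suc (suc zero))          zero    = refl
  evaluate (suc (suc (suc n)))       zero    = refl
  evaluate zero                      (suc k) = refl
  evaluate (suc zero)                (suc k) = refl
  evaluate (suc (suc zero))          (suc k) = refl
  evaluate (suc (suc (suc n)))       (suc k) = refl

Disc-as-square : Disc ≈ inX (λ n → (quadratic ⋆ quadratic) n - + 4 * shift (shift δ₀) n)
Disc-as-square n k
  rewrite ⊛-X (⊛-X (⊛-X (≈-refl {X}))) n k
        | ⊛-X (⊛-X (⊛-X (≈-refl {cst (+ 2)}))) n k
        | ⊛-X (≈-refl {X}) n k
        | ⊛-X (≈-refl {cst (+ 2)}) n k
        = evaluate n k
  where
  terms : Ser
  terms n k = shiftX (shiftX (shiftX X)) n k - shiftX (shiftX (shiftX (cst (+ 2)))) n k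
              - shiftX X n k - shiftX (cst (+ 2)) n k + cst (+ 1) n k
  evaluate : ∀ n k → terms n k ≡ inX (λ n → (quadratic ⋆ quadratic) n - + 4 * shift (shift δ₀) n) n k
  evaluate zero                                  zero    = refl
  evaluate (suc zero)                            zero    = refl
  evaluate (suc (suc zero))                      zero    = refl
  evaluate (suc (suc (suc zero)))                zero    = refl
  evaluate (suc (suc (suc (suc zero))))          zero    = refl
  evaluate (suc (suc (suc (suc (suc n)))))       zero    =
    sym (cong (_- + 4 * 0ℤ) (quadratic-⋆ quadratic (suc (suc (suc (suc (suc n)))))))
  evaluate zero                                  (suc k) = refl
  evaluate (suc zero)                            (suc k) = refl
  evaluate (suc (suc zero))                      (suc k) = refl
  evaluate (suc (suc (suc zero)))                (suc k) = refl
  evaluate (suc (suc (suc (suc zero))))          (suc k) = refl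
  evaluate (suc (suc (suc (suc (suc n)))))       (suc k) = refl

indicator : Bool → ℤ
indicator b = if b then 1ℤ else 0ℤ

count : {A : Set} → (A → Bool) → List A → ℤ
count P []       = 0ℤ
count P (x ∷ xs) = indicator (P x) + count P xs

length-filterᵇ : ∀ {A : Set} (P : A → Bool) xs → + length (filterᵇ P xs) ≡ count P xs
length-filterᵇ P []       = refl
length-filterᵇ P (x ∷ xs) with P x
... | true  = cong (_+_ 1ℤ) (length-filterᵇ P xs)
... | false = trans (length-filterᵇ P xs) (sym (+-identityˡ _))

count-++ : ∀ {A : Set} (P : A → Bool) xs ys → count P (xs ++ ys) ≡ count P xs + count P ys
count-++ P []       ys = sym (+-identityˡ _)
count-++ P (x ∷ xs) ys =
  trans (cong (_+_ (indicator (P x))) (count-++ P xs ys)) (sym (+-assoc (indicator (P x)) _ _))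

count-cong : ∀ {A : Set} {P Q : A → Bool} → (∀ x → P x ≡ Q x) → ∀ xs → count P xs ≡ count Q xs
count-cong P≡Q []       = refl
count-cong P≡Q (x ∷ xs) = cong₂ (λ b n → indicator b + n) (P≡Q x) (count-cong P≡Q xs)

count-false : ∀ {A : Set} (xs : List A) → count (λ _ → false) xs ≡ 0ℤ
count-false []       = refl
count-false (x ∷ xs) = trans (+-identityˡ _) (count-false xs)

count-prefixes-[] : ∀ (P : List Step → Bool) ws → count P (concatMap (λ w → map (_∷ w) []) ws) ≡ 0ℤ
count-prefixes-[] P []       = refl
count-prefixes-[] P (w ∷ ws) = count-prefixes-[] P ws

count-prefixes-∷ : ∀ (P : List Step → Bool) l L ws →
                   count P (concatMap (λ w → map (_∷ w) (l ∷ L)) ws)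
                     ≡ count (λ w → P (l ∷ w)) ws + count P (concatMap (λ w → map (_∷ w) L) ws)
count-prefixes-∷ P l L []       = refl
count-prefixes-∷ P l L (w ∷ ws) = begin
  indicator (P (l ∷ w)) + count P (map (_∷ w) L ++ rest (l ∷ L))
    ≡⟨ cong (_+_ (indicator (P (l ∷ w)))) (count-++ P (map (_∷ w) L) (rest (l ∷ L))) ⟩
  indicator (P (l ∷ w)) + (count P (map (_∷ w) L) + count P (rest (l ∷ L)))
    ≡⟨ cong (λ t → indicator (P (l ∷ w)) + (count P (map (_∷ w) L) + t)) (count-prefixes-∷ P l L ws) ⟩
  indicator (P (l ∷ w)) + (count P (map (_∷ w) L) + (count (λ v → P (l ∷ v)) ws + count P (rest L)))
    ≡⟨ sym (+-assoc (indicator (P (l ∷ w))) _ _) ⟩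
  indicator (P (l ∷ w)) + count P (map (_∷ w) L) + (count (λ v → P (l ∷ v)) ws + count P (rest L))
    ≡⟨ interchange (indicator (P (l ∷ w))) (count P (map (_∷ w) L)) (count (λ v → P (l ∷ v)) ws) (count P (rest L)) ⟩
  count (λ v → P (l ∷ v)) (w ∷ ws) + (count P (map (_∷ w) L) + count P (rest L))
    ≡⟨ cong (_+_ (count (λ v → P (l ∷ v)) (w ∷ ws))) (count-++ P (map (_∷ w) L) (rest L)) ⟨
  count (λ v → P (l ∷ v)) (w ∷ ws) + count P (map (_∷ w) L ++ rest L)
    ∎
  where
  rest : List Step → List (List Step)
  rest L = concatMap (λ v → map (_∷ v) L) ws

count-prefixes-D : ∀ (P : List Step → Bool) g b ws →
                   count P (concatMap (λ w → map (_∷ w) (map D (applyUpTo g b))) ws)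
                     ≡ sumBelow b (λ m → count (λ w → P (D (g m) ∷ w)) ws)
count-prefixes-D P g zero    ws = count-prefixes-[] P ws
count-prefixes-D P g (suc b) ws =
  trans (count-prefixes-∷ P (D (g 0)) (map D (applyUpTo (g ∘ suc) b)) ws)
        (trans (cong (_+_ (count (λ w → P (D (g 0) ∷ w)) ws)) (count-prefixes-D P (g ∘ suc) b ws))
               (sym (sumBelow-cons b (λ m → count (λ w → P (D (g m) ∷ w)) ws))))

count-words-suc : ∀ (P : List Step → Bool) b n →
                  count P (words b (suc n))
                    ≡ count (λ w → P (U ∷ w)) (words b n) + sumBelow b (λ m → count (λ w → P (D m ∷ w)) (words b n))
count-words-suc P b n =
  trans (count-prefixes-∷ P U (map D (applyUpTo id b)) (words b n))
        (cong (_+_ (count (λ w → P (U ∷ w)) (words b n))) (count-prefixes-D P id b (words b n)))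

-- A walk is in state (h, f) at height h, where f tells whether its last step was a down-step,
-- which forbids another one.
unlessDown : Bool → ℤ → ℤ
unlessDown true  _ = 0ℤ
unlessDown false x = x

emptyWalk : ℕ → ℕ → ℤ
emptyWalk n zero    = δ₀ n
emptyWalk n (suc h) = 0ℤ

-- paths n h f k: continuations of length n from state (h, f) that end on the axis after exactly
-- k returns; landing n j k: the same after a down-step to height j, which is a return if j = 0.
mutual
  paths : ℕ → ℕ → Bool → ℕ → ℤ
  paths zero    h f zero    = emptyWalk 0 h
  paths zero    h f (suc k) = 0ℤ
  paths (suc n) h f k       = paths n (suc h) false k + unlessDown f (sumBelow h (λ j → landing n j k))

  landing : ℕ → ℕ → ℕ → ℤ
  landing n zero    zero    = 0ℤ
  landing n zero    (suc k) = paths n zero true k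
  landing n (suc j) k       = paths n (suc j) true k

walksCount : ℕ → ℕ → ℕ → Bool → ℕ → ℤ
walksCount b n h f k = count (λ p → go h f p ∧ (returnsFrom h p ≡ᵇ k)) (words b n)

≤ᵇ-true : ∀ {m n} → m ≤ n → (m ≤ᵇ n) ≡ true
≤ᵇ-true m≤n = Equivalence.to T-≡ (ℕₚ.≤⇒≤ᵇ m≤n)

≤ᵇ-false : ∀ {m n} → n < m → (m ≤ᵇ n) ≡ false
≤ᵇ-false {m} {n} n<m = ¬-not (λ m≤ᵇn≡true → ℕₚ.<⇒≱ n<m (ℕₚ.≤ᵇ⇒≤ m n (Equivalence.from T-≡ m≤ᵇn≡true)))

go-down-blocked : ∀ {h m} → h ≤ m → ∀ w → go h false (D m ∷ w) ≡ false
go-down-blocked {h} {m} h≤m w rewrite ≤ᵇ-false {suc m} {h} (s≤s h≤m) = refl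

go-down-allowed : ∀ {h m} → m < h → ∀ w → go h false (D m ∷ w) ≡ go (h ∸ suc m) true w
go-down-allowed {h} {m} m<h w rewrite ≤ᵇ-true m<h = refl

landedAt : ℕ → ℕ → List Step → Bool
landedAt j k w = go j true w ∧ (((if j ≡ᵇ 0 then 1 else 0) ℕ.+ returnsFrom j w) ≡ᵇ k)

count-down-steps : ∀ {h b} k ws → h ≤ b →
  sumBelow b (λ m → count (λ w → go h false (D m ∷ w) ∧ (returnsFrom h (D m ∷ w) ≡ᵇ k)) ws)
    ≡ sumBelow h (λ j → count (landedAt j k) ws)
count-down-steps {h} {b} k ws h≤b = begin
  sumBelow b (λ m → count (afterStep m) ws)
    ≡⟨ sumBelow-truncate (λ m → count (afterStep m) ws) h≤b
         (λ m h≤m → trans (count-cong (blocked h≤m) ws) (count-false ws)) ⟩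
  sumBelow h (λ m → count (afterStep m) ws)
    ≡⟨ sumBelow-cong h (λ m m<h → count-cong (allowed m<h) ws) ⟩
  sumBelow h (λ m → count (landedAt (h ∸ suc m) k) ws)
    ≡⟨ sumBelow-reverse h (λ j → count (landedAt j k) ws) ⟩
  sumBelow h (λ j → count (landedAt j k) ws)
    ∎
  where
  afterStep : ℕ → List Step → Bool
  afterStep m w = go h false (D m ∷ w) ∧ (returnsFrom h (D m ∷ w) ≡ᵇ k)
  blocked : ∀ {m} → h ≤ m → ∀ w → afterStep m w ≡ false
  blocked {m} h≤m w = cong (_∧ (returnsFrom h (D m ∷ w) ≡ᵇ k)) (go-down-blocked h≤m w)
  allowed : ∀ {m} → m < h → ∀ w → afterStep m w ≡ landedAt (h ∸ suc m) k w
  allowed {m} m<h w = cong (_∧ (returnsFrom h (D m ∷ w) ≡ᵇ k)) (go-down-allowed m<h w)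

count-walks : ∀ n b h f k → h ℕ.+ n ≤ b → walksCount b n h f k ≡ paths n h f k
count-walks zero    b zero    f zero    _ = refl
count-walks zero    b zero    f (suc k) _ = refl
count-walks zero    b (suc h) f zero    _ = refl
count-walks zero    b (suc h) f (suc k) _ = refl
count-walks (suc n) b h       f k       h+n≤b = begin
  walksCount b (suc n) h f k
    ≡⟨ count-words-suc (λ p → go h f p ∧ (returnsFrom h p ≡ᵇ k)) b n ⟩
  walksCount b n (suc h) false k + sumBelow b (λ m → count (λ w → go h f (D m ∷ w) ∧ (returnsFrom h (D m ∷ w) ≡ᵇ k)) ws)
    ≡⟨ cong₂ _+_ (count-walks n b (suc h) false k (subst (_≤ b) (ℕₚ.+-suc h n) h+n≤b)) (down-steps f) ⟩
  paths (suc n) h f k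
    ∎
  where
  ws : List (List Step)
  ws = words b n
  bound : ∀ {j} → j < h → j ℕ.+ n ≤ b
  bound j<h = ℕₚ.≤-trans (ℕₚ.+-monoˡ-≤ n (ℕₚ.<⇒≤ j<h)) (ℕₚ.≤-trans (ℕₚ.+-monoʳ-≤ h (ℕₚ.n≤1+n n)) h+n≤b)
  landing-count : ∀ j k → j < h → count (landedAt j k) ws ≡ landing n j k
  landing-count zero    zero    _   = trans (count-cong (λ w → ∧-zeroʳ (go 0 true w)) ws) (count-false ws)
  landing-count zero    (suc k) j<h = count-walks n b zero true k (bound j<h)
  landing-count (suc j) k       j<h = count-walks n b (suc j) true k (bound j<h)
  down-steps : ∀ f → sumBelow b (λ m → count (λ w → go h f (D m ∷ w) ∧ (returnsFrom h (D m ∷ w) ≡ᵇ k)) ws)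
                     ≡ unlessDown f (sumBelow h (λ j → landing n j k))
  down-steps true  = sumBelow-zero b (λ m → count-false ws)
  down-steps false = trans (count-down-steps k ws (ℕₚ.≤-trans (ℕₚ.m≤m+n h (suc n)) h+n≤b))
                           (sumBelow-cong h (λ j j<h → landing-count j k j<h))

-- isAirDyck and go 0 false agree on nonempty words, so both counts split into the same sum.
r-suc : ∀ n k → + r (suc n) k ≡ paths (suc n) 0 false k
r-suc n k = begin
  + r (suc n) k                                    ≡⟨ length-filterᵇ isReturnPath (words (suc n) (suc n)) ⟩
  count isReturnPath (words (suc n) (suc n))        ≡⟨ count-words-suc isReturnPath (suc n) n ⟩
  _                                                ≡⟨ count-words-suc (λ p → go 0 false p ∧ (returns p ≡ᵇ k)) (suc n) n ⟨
  walksCount (suc n) (suc n) 0 false k              ≡⟨ count-walks (suc n) (suc n) 0 false k ℕₚ.≤-refl ⟩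
  paths (suc n) 0 false k                          ∎
  where
  isReturnPath : List Step → Bool
  isReturnPath p = isAirDyck p ∧ (returns p ≡ᵇ k)

-- paths also counts the empty walk, which accounts for the 1 in R + 1.
R+1≈paths : R ⊕ cst (+ 1) ≈ λ n k → paths n 0 false k
R+1≈paths zero    zero    = refl
R+1≈paths zero    (suc k) = refl
R+1≈paths (suc n) k       = trans (+-identityʳ (+ r (suc n) k)) (r-suc n k)

-- firstPassages n h f: continuations of length n from state (h, f) whose only visit to the axis
-- is their last step; passageLanding n j: the ways to finish one after a down-step to height j.
mutual
  firstPassages : ℕ → ℕ → Bool → ℤ
  firstPassages zero    h f = 0ℤ
  firstPassages (suc n) h f =
    firstPassages n (suc h) false + unlessDown f (sumBelow h (λ j → passageLanding n j))

  passageLanding : ℕ → ℕ → ℤ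
  passageLanding n zero    = δ₀ n
  passageLanding n (suc j) = firstPassages n (suc j) true

-- continuations of length n from state (h, f) ending on the axis
toAxis : ℕ → ℕ → Bool → ℤ
toAxis zero    h f = emptyWalk 0 h
toAxis (suc n) h f = toAxis n (suc h) false + unlessDown f (sumBelow h (λ j → toAxis n j true))

unlessDown-zero : ∀ f → unlessDown f 0ℤ ≡ 0ℤ
unlessDown-zero true  = refl
unlessDown-zero false = refl

unlessDown-*ʳ : ∀ f x c → unlessDown f x * c ≡ unlessDown f (x * c)
unlessDown-*ʳ true  x c = refl
unlessDown-*ʳ false x c = refl

sumTo-unlessDown : ∀ n f (g : ℕ → ℤ) → sumTo n (λ i → unlessDown f (g i)) ≡ unlessDown f (sumTo n g)
sumTo-unlessDown n true  g = sumTo-zero n (λ _ → refl)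
sumTo-unlessDown n false g = refl

-- Convolving with first passages obeys the same one-step recursion as the walks themselves.
firstPassages-⋆-suc : ∀ n h f E →
  ((λ i → firstPassages i h f) ⋆ E) (suc n)
    ≡ ((λ i → firstPassages i (suc h) false) ⋆ E) n
      + unlessDown f (sumBelow h (λ j → ((λ i → passageLanding i j) ⋆ E) n))
firstPassages-⋆-suc n h f E = begin
  ((λ i → firstPassages i h f) ⋆ E) (suc n)
    ≡⟨ trans (sumTo-cons n (λ i → firstPassages i h f * E (suc n ∸ i))) (+-identityˡ _) ⟩
  sumTo n (λ i → (firstPassages i (suc h) false + unlessDown f (landings i)) * E (n ∸ i))
    ≡⟨ sumTo-cong n (λ i _ → *-distribʳ-+ (E (n ∸ i)) (firstPassages i (suc h) false) (unlessDown f (landings i))) ⟩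
  sumTo n (λ i → firstPassages i (suc h) false * E (n ∸ i) + unlessDown f (landings i) * E (n ∸ i))
    ≡⟨ sumTo-+ n (λ i → firstPassages i (suc h) false * E (n ∸ i)) (λ i → unlessDown f (landings i) * E (n ∸ i)) ⟩
  ((λ i → firstPassages i (suc h) false) ⋆ E) n + sumTo n (λ i → unlessDown f (landings i) * E (n ∸ i))
    ≡⟨ cong (_+_ (((λ i → firstPassages i (suc h) false) ⋆ E) n)) landings-⋆ ⟩
  ((λ i → firstPassages i (suc h) false) ⋆ E) n + unlessDown f (sumBelow h (λ j → ((λ i → passageLanding i j) ⋆ E) n))
    ∎
  where
  landings : ℕ → ℤ
  landings i = sumBelow h (passageLanding i)
  landings-⋆ : sumTo n (λ i → unlessDown f (landings i) * E (n ∸ i))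
               ≡ unlessDown f (sumBelow h (λ j → ((λ i → passageLanding i j) ⋆ E) n))
  landings-⋆ = begin
    sumTo n (λ i → unlessDown f (landings i) * E (n ∸ i))
      ≡⟨ sumTo-cong n (λ i _ → trans (unlessDown-*ʳ f (landings i) (E (n ∸ i)))
                                     (cong (unlessDown f) (sumBelow-*ʳ h (E (n ∸ i)) (passageLanding i)))) ⟩
    sumTo n (λ i → unlessDown f (sumBelow h (λ j → passageLanding i j * E (n ∸ i))))
      ≡⟨ sumTo-unlessDown n f (λ i → sumBelow h (λ j → passageLanding i j * E (n ∸ i))) ⟩
    unlessDown f (sumTo n (λ i → sumBelow h (λ j → passageLanding i j * E (n ∸ i))))
      ≡⟨ cong (unlessDown f) (sumTo-sumBelow-swap n h (λ i j → passageLanding i j * E (n ∸ i))) ⟩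
    unlessDown f (sumBelow h (λ j → ((λ i → passageLanding i j) ⋆ E) n))
      ∎

-- Cutting a walk at its first return.
paths-returns-suc : ∀ n h f k →
  paths n h f (suc k) ≡ ((λ i → firstPassages i h f) ⋆ (λ m → paths m 0 true k)) n
paths-returns-suc zero    h f k = refl
paths-returns-suc (suc n) h f k = sym (begin
  (Z ⋆ E) (suc n)
    ≡⟨ firstPassages-⋆-suc n h f E ⟩
  ((λ i → firstPassages i (suc h) false) ⋆ E) n + unlessDown f (sumBelow h (λ j → ((λ i → passageLanding i j) ⋆ E) n))
    ≡⟨ cong₂ _+_ (sym (paths-returns-suc n (suc h) false k))
                 (cong (unlessDown f) (sumBelow-cong h (λ j _ → landing-returns j))) ⟩
  paths (suc n) h f (suc k)
    ∎)
  where
  Z E : ℕ → ℤ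
  Z i = firstPassages i h f
  E m = paths m 0 true k
  landing-returns : ∀ j → ((λ i → passageLanding i j) ⋆ E) n ≡ landing n j (suc k)
  landing-returns zero    = δ₀-⋆ E n
  landing-returns (suc j) = sym (paths-returns-suc n (suc j) true k)

paths-no-returns : ∀ n h f → paths n h f 0 ≡ emptyWalk n h
paths-no-returns zero    h f = refl
paths-no-returns (suc n) h f = begin
  paths n (suc h) false 0 + unlessDown f (sumBelow h (λ j → landing n j 0))
    ≡⟨ cong₂ _+_ (paths-no-returns n (suc h) false)
                 (trans (cong (unlessDown f) (sumBelow-zero h landing-no-returns)) (unlessDown-zero f)) ⟩
  0ℤ + 0ℤ
    ≡⟨ emptyWalk-suc h ⟨
  emptyWalk (suc n) h
    ∎
  where
  landing-no-returns : ∀ j → landing n j 0 ≡ 0ℤ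
  landing-no-returns zero    = refl
  landing-no-returns (suc j) = paths-no-returns n (suc j) true
  emptyWalk-suc : ∀ h → emptyWalk (suc n) h ≡ 0ℤ + 0ℤ
  emptyWalk-suc zero    = refl
  emptyWalk-suc (suc h) = refl

toAxis-decomposition : ∀ n h f →
  toAxis n h f ≡ emptyWalk n h + ((λ i → firstPassages i h f) ⋆ (λ m → toAxis m 0 true)) n
toAxis-decomposition zero    h f = sym (+-identityʳ (emptyWalk 0 h))
toAxis-decomposition (suc n) h f = sym (begin
  emptyWalk (suc n) h + (Z ⋆ E) (suc n)
    ≡⟨ cong (_+ (Z ⋆ E) (suc n)) (emptyWalk-suc h) ⟩
  0ℤ + (Z ⋆ E) (suc n)
    ≡⟨ trans (+-identityˡ _) (firstPassages-⋆-suc n h f E) ⟩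
  ((λ i → firstPassages i (suc h) false) ⋆ E) n + unlessDown f (sumBelow h (λ j → ((λ i → passageLanding i j) ⋆ E) n))
    ≡⟨ cong₂ _+_ (trans (sym (+-identityˡ (((λ i → firstPassages i (suc h) false) ⋆ E) n)))
                        (sym (toAxis-decomposition n (suc h) false)))
                 (cong (unlessDown f) (sumBelow-cong h (λ j _ → landing-decomposition j))) ⟩
  toAxis (suc n) h f
    ∎)
  where
  Z E : ℕ → ℤ
  Z i = firstPassages i h f
  E m = toAxis m 0 true
  emptyWalk-suc : ∀ h → emptyWalk (suc n) h ≡ 0ℤ
  emptyWalk-suc zero    = refl
  emptyWalk-suc (suc h) = refl
  landing-decomposition : ∀ j → ((λ i → passageLanding i j) ⋆ E) n ≡ toAxis n j true
  landing-decomposition zero    = δ₀-⋆ E n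
  landing-decomposition (suc j) =
    trans (sym (+-identityˡ (((λ i → passageLanding i (suc j)) ⋆ E) n))) (sym (toAxis-decomposition n (suc j) true))

firstPassages-lower : ∀ n h f → firstPassages (suc (suc n)) (suc h) f ≡ toAxis (suc (suc n)) h f
firstPassages-lower zero    h f =
  cong₂ _+_ (cong (_+_ 0ℤ) (begin
               sumTo h (passageLanding 0) + 0ℤ   ≡⟨ +-identityʳ _ ⟩
               sumTo h (passageLanding 0)        ≡⟨ sumTo-cong h (λ j _ → landing-empty j) ⟩
               sumTo h (λ j → emptyWalk 0 j)     ∎))
            (cong (unlessDown f) (trans (sumTo-zero h landing-vanishes) (sym (sumBelow-zero h (λ _ → refl)))))
  where
  landing-empty : ∀ j → passageLanding 0 j ≡ emptyWalk 0 j
  landing-empty zero    = refl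
  landing-empty (suc j) = refl
  landing-vanishes : ∀ j → passageLanding 1 j ≡ 0ℤ
  landing-vanishes zero    = refl
  landing-vanishes (suc j) = refl
firstPassages-lower (suc n) h f =
  cong₂ _+_ (firstPassages-lower n (suc h) false)
            (cong (unlessDown f) (begin
               sumBelow (suc h) (passageLanding (suc (suc n)))
                 ≡⟨ trans (sumBelow-cons h (passageLanding (suc (suc n)))) (+-identityˡ _) ⟩
               sumBelow h (λ j → firstPassages (suc (suc n)) (suc j) true)
                 ≡⟨ sumBelow-cong h (λ j _ → firstPassages-lower n j true) ⟩
               sumBelow h (λ j → toAxis (suc (suc n)) j true)
                 ∎))

-- first-return paths (primes) and all paths, including the empty one, by length
primes allPaths : ℕ → ℤ
primes   n = firstPassages n 0 false
allPaths n = toAxis n 0 false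

paths-flag-at-axis : ∀ n k → paths n 0 true k ≡ paths n 0 false k
paths-flag-at-axis zero    zero    = refl
paths-flag-at-axis zero    (suc k) = refl
paths-flag-at-axis (suc n) k       = refl

toAxis-flag-at-axis : ∀ n → toAxis n 0 true ≡ toAxis n 0 false
toAxis-flag-at-axis zero    = refl
toAxis-flag-at-axis (suc n) = refl

paths-returns : ∀ n k → paths n 0 false (suc k) ≡ (primes ⋆ (λ m → paths m 0 false k)) n
paths-returns n k =
  trans (paths-returns-suc n 0 false k) (⋆-cong {primes} (λ _ → refl) (λ m → paths-flag-at-axis m k) n)

allPaths-decomposition : ∀ n → allPaths n ≡ δ₀ n + (primes ⋆ allPaths) n
allPaths-decomposition n =
  trans (toAxis-decomposition n 0 false)
        (cong (_+_ (δ₀ n)) (⋆-cong {primes} (λ _ → refl) toAxis-flag-at-axis n))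

primes-suc : ∀ i → primes (suc i) ≡ allPaths i - δ₀ i + shift δ₀ i
primes-suc zero          = refl
primes-suc (suc zero)    = refl
primes-suc (suc (suc i)) = begin
  firstPassages (suc (suc i)) 1 false + 0ℤ      ≡⟨ +-identityʳ _ ⟩
  firstPassages (suc (suc i)) 1 false           ≡⟨ firstPassages-lower i 0 false ⟩
  allPaths (suc (suc i))                        ≡⟨ +-identityʳ _ ⟨
  allPaths (suc (suc i)) + 0ℤ                   ≡⟨ +-identityʳ _ ⟨
  allPaths (suc (suc i)) - 0ℤ + 0ℤ              ∎

primes-square : primes ⋆ primes ≗ λ n → (quadratic ⋆ primes) n - shift (shift δ₀) n
primes-square zero    = refl
primes-square (suc m) = begin
  (primes ⋆ primes) (suc m)
    ≡⟨ ⋆-suc primes primes m refl ⟩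
  ((primes ∘ suc) ⋆ primes) m
    ≡⟨ ⋆-cong {b = primes} primes-suc (λ _ → refl) m ⟩
  ((λ i → allPaths i - δ₀ i + shift δ₀ i) ⋆ primes) m
    ≡⟨ ⋆-distribʳ-+ (λ i → allPaths i - δ₀ i) (shift δ₀) primes m ⟩
  ((λ i → allPaths i - δ₀ i) ⋆ primes) m + (shift δ₀ ⋆ primes) m
    ≡⟨ cong₂ _+_ (⋆-distribʳ-- allPaths δ₀ primes m) (shift-δ₀-⋆ primes m) ⟩
  (allPaths ⋆ primes) m - (δ₀ ⋆ primes) m + shift primes m
    ≡⟨ cong₂ (λ u v → u - v + shift primes m) (⋆-comm allPaths primes m) (δ₀-⋆ primes m) ⟩
  (primes ⋆ allPaths) m - primes m + shift primes m
    ≡⟨ collect (allPaths m) (δ₀ m) ((primes ⋆ allPaths) m) (primes (suc m)) (shift δ₀ m) (primes m) (shift primes m)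
               (allPaths-decomposition m) (primes-suc m) ⟩
  primes (suc m) - primes m + shift primes m - shift δ₀ m
    ≡⟨ cong (_- shift δ₀ m) (quadratic-⋆ primes (suc m)) ⟨
  (quadratic ⋆ primes) (suc m) - shift (shift δ₀) (suc m)
    ∎
  where
  collect : ∀ (w d c q₁ e q s : ℤ) → w ≡ d + c → q₁ ≡ w - d + e → c - q + s ≡ q₁ - q + s - e
  collect w d c q₁ e q s refl refl = solution d c e q s
    where
    solution : ∀ (d c e q s : ℤ) → c - q + s ≡ d + c - d + e - q + s - e
    solution = solve-∀

sqrtDisc : ℕ → ℤ
sqrtDisc n = quadratic n - + 2 * primes n

sqrtDisc-isSqrtDisc : IsSqrtDisc sqrtDisc
sqrtDisc-isSqrtDisc = refl , λ n k → begin
  (inX sqrtDisc ⊛ inX sqrtDisc) n k                                          ≡⟨ inX-⊛-inX sqrtDisc sqrtDisc n k ⟩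
  inX (sqrtDisc ⋆ sqrtDisc) n k                                              ≡⟨ inX-cong sqrtDisc-square n k ⟩
  inX (λ n → (quadratic ⋆ quadratic) n - + 4 * shift (shift δ₀) n) n k      ≡⟨ Disc-as-square n k ⟨
  Disc n k                                                                   ∎
  where
  sqrtDisc-square : sqrtDisc ⋆ sqrtDisc ≗ λ n → (quadratic ⋆ quadratic) n - + 4 * shift (shift δ₀) n
  sqrtDisc-square = square-completion quadratic primes (shift (shift δ₀)) primes-square

IsSqrtDisc⇒≗sqrtDisc : ∀ {S} → IsSqrtDisc S → S ≗ sqrtDisc
IsSqrtDisc⇒≗sqrtDisc {S} (S₀≡1 , S²≈Disc) =
  ⋆-square-unique S sqrtDisc S₀≡1 refl (λ n → trans (S²≈Disc n 0) (sym (proj₂ sqrtDisc-isSqrtDisc n 0)))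

twice-primes : ∀ {S} → S ≗ sqrtDisc → cst (+ 1) ⊖ X ⊕ X ⊛ X ⊖ inX S ≈ inX (λ n → + 2 * primes n)
twice-primes {S} S≗ n k =
  trans (cong (_- inX S n k) (quadratic-series n k))
        (trans (inX-⊖ quadratic S n k)
               (inX-cong (λ n → trans (cong (_-_ (quadratic n)) (S≗ n)) (cancel (quadratic n) (primes n))) n k))
  where
  cancel : ∀ (c q : ℤ) → c - (c - + 2 * q) ≡ + 2 * q
  cancel = solve-∀

returns-series : ∀ {S} → S ≗ sqrtDisc →
  (cst (+ 2) ⊖ Y ⊛ (cst (+ 1) ⊖ X ⊕ X ⊛ X ⊖ inX S)) ⊛ (R ⊕ cst (+ 1)) ≈ cst (+ 2)
returns-series {S} S≗ n k = begin
  ((cst (+ 2) ⊖ Y ⊛ K) ⊛ (R ⊕ cst (+ 1))) n k    ≡⟨ ⊛-cong (≈-refl {cst (+ 2) ⊖ Y ⊛ K}) R+1≈paths n k ⟩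
  ((cst (+ 2) ⊖ Y ⊛ K) ⊛ C) n k                  ≡⟨ ⊛-distribʳ-⊖ (cst (+ 2)) (Y ⊛ K) C n k ⟩
  (cst (+ 2) ⊛ C) n k - (Y ⊛ K ⊛ C) n k          ≡⟨ cong₂ _-_ (cst-⊛ (+ 2) C n k) (yK⊛C n k) ⟩
  + 2 * C n k - shiftY 2QC n k                   ≡⟨ balance n k ⟩
  cst (+ 2) n k                                  ∎
  where
  K C 2QC : Ser
  K   = cst (+ 1) ⊖ X ⊕ X ⊛ X ⊖ inX S
  C n k = paths n 0 false k
  2QC n k = + 2 * (primes ⋆ (λ i → C i k)) n
  yK⊛C : Y ⊛ K ⊛ C ≈ shiftY 2QC
  yK⊛C = ≈-trans (⊛-cong (Y-⊛ K) (≈-refl {C}))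
                 (≈-trans (shiftY-⊛ K C) (shiftY-cong λ n k →
                   trans (⊛-cong (twice-primes S≗) (≈-refl {C}) n k)
                         (trans (inX-⊛ (λ n → + 2 * primes n) C n k) (⋆-scaleˡ (+ 2) primes (λ i → C i k) n))))
  balance : ∀ n k → + 2 * C n k - shiftY 2QC n k ≡ cst (+ 2) n k
  balance n zero    = trans (cong (λ t → + 2 * t - 0ℤ) (paths-no-returns n 0 false)) (constant n)
    where
    constant : ∀ n → + 2 * δ₀ n - 0ℤ ≡ cst (+ 2) n 0
    constant zero    = refl
    constant (suc n) = refl
  balance n (suc k) = trans (cong (λ t → + 2 * t - 2QC n k) (paths-returns n k)) (trans (+-inverseʳ (2QC n k)) (vanish n))
    where
    vanish : ∀ n → 0ℤ ≡ cst (+ 2) n (suc k)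
    vanish zero    = refl
    vanish (suc n) = refl

theorem4 : Σ (ℕ → ℤ) IsSqrtDisc
           × ((S : ℕ → ℤ) → IsSqrtDisc S →
               (cst (+ 2) ⊖ Y ⊛ (cst (+ 1) ⊖ X ⊕ X ⊛ X ⊖ inX S)) ⊛ (R ⊕ cst (+ 1))
                 ≈ cst (+ 2))
theorem4 = (sqrtDisc , sqrtDisc-isSqrtDisc) , λ S isSqrt → returns-series (IsSqrtDisc⇒≗sqrtDisc isSqrt)
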